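{- Let $n\in\mathbb{N}=\{0,1,2,\ldots\}$ and $r\in\{1,7,13\}$, and let $f_2(x,y,z)=3x^2+4y^2+4z^2+2yz$. If $15n+r=f_2(x,y,z)$ for some $x,y,z\in\mathbb{Z}$, then there exist $u,v,w\in\mathbb{Z}$ with $u+2v-2w\not\equiv0\pmod 3$ such that $15n+r=f_2(u,v,w)$. -}

module Defs where

open import Data.Integer using (ℤ; +_; _+_; _*_; _-_)

f₂ : ℤ → ℤ → ℤ → ℤ
f₂ x y z = + 3 * (x * x) + + 4 * (y * y) + + 4 * (z * z) + + 2 * (y * z)

-- Write a representation as f₂ x (z + d) z. If x = 3pa and d = 3pb, the integral substitution
-- x′ = p(a + 2b), d′ = p(b − 4a), z′ = p(2a − 2b) − z preserves f₂; as f₂ is even in x we may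
-- assume 3 ∤ a + 2b, so 3 ∤ x′/p. Descending on the power of 3 dividing (x, d) thus ends at a
-- representation with 3 ∤ x + 2d = u + 2v − 2w. The descent needs (x, d) ≠ (0, 0), which holds
-- because f₂ 0 z z = 10z² while 5 ∤ 15n + r.

module Submission where

open import Defs
open import Data.Nat using (ℕ)
open import Data.Integer using (ℤ; +_; _+_; _*_; _-_)
open import Data.Integer.Divisibility using (_∣_)
open import Data.Product using (_×_; ∃-syntax)
open import Data.Sum using (_⊎_)
open import Relation.Nullary using (¬_)
open import Relation.Binary.PropositionalEquality using (_≡_)

import Data.Nat as ℕ
import Data.Nat.Properties as ℕ
import Data.Nat.Divisibility as ℕ
open import Data.Nat.Induction using (<-wellFounded)
open import Data.Integer using (-_; 0ℤ; ∣_∣)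
open import Data.Integer.Properties using (pos-*; abs-*; *-comm; *-assoc; *-identityˡ; neg-distribʳ-*; ∣i∣≡0⇒i≡0; i-j≡0⇒i≡j)
open import Data.Integer.Divisibility.Signed
  using (divides; ∣ᵤ⇒∣; ∣⇒∣ᵤ; ∣-refl; ∣m∣n⇒∣m+n; ∣m∣n⇒∣m-n; ∣n⇒∣m*n)
  renaming (_∣_ to _∣ₛ_; _∣?_ to _∣ₛ?_)
open import Data.Integer.Solver using (module +-*-Solver)
open import Data.Integer.Tactic.RingSolver using (solve-∀)
open import Data.Product using (_,_; proj₁; proj₂)
open import Data.Sum using (inj₁; inj₂)
open import Function using (_∘_)
open import Induction.WellFounded using (Acc; acc)
open import Relation.Nullary using (yes; no; contradiction)
open import Relation.Nullary.Decidable using (from-no)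
open import Relation.Binary.PropositionalEquality
  using (_≢_; refl; sym; trans; cong; cong₂; subst; module ≡-Reasoning)

power-split : ∀ m → 1 ℕ.< m → ∀ x d → ¬ (x ≡ 0ℤ × d ≡ 0ℤ) →
  ∃[ k ] ∃[ a ] ∃[ b ] (x ≡ + (m ℕ.^ k) * a × d ≡ + (m ℕ.^ k) * b × ¬ (+ m ∣ₛ a × + m ∣ₛ b))
power-split m 1<m x d x,d≢0 = go x d x,d≢0 (<-wellFounded _)
  where
  rescale : ∀ {q a} k → q ≡ + (m ℕ.^ k) * a → q * + m ≡ + (m ℕ.^ ℕ.suc k) * a
  rescale {a = a} k refl = begin
    (+ (m ℕ.^ k) * a) * + m   ≡⟨ *-comm (+ (m ℕ.^ k) * a) (+ m) ⟩
    + m * (+ (m ℕ.^ k) * a)   ≡⟨ *-assoc (+ m) (+ (m ℕ.^ k)) a ⟨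
    (+ m * + (m ℕ.^ k)) * a   ≡⟨ cong (_* a) (pos-* m (m ℕ.^ k)) ⟨
    + (m ℕ.^ ℕ.suc k) * a     ∎
    where open ≡-Reasoning

  shrinks : ∀ q₁ q₂ → ¬ (q₁ * + m ≡ 0ℤ × q₂ * + m ≡ 0ℤ) →
            ∣ q₁ ∣ ℕ.+ ∣ q₂ ∣ ℕ.< ∣ q₁ * + m ∣ ℕ.+ ∣ q₂ * + m ∣
  shrinks q₁ q₂ q≢0 = begin-strict
    s                         <⟨ ℕ.m<m*n s m 1<m ⟩
    s ℕ.* m                   ≡⟨ ℕ.*-distribʳ-+ m ∣ q₁ ∣ ∣ q₂ ∣ ⟩
    ∣ q₁ ∣ ℕ.* m ℕ.+ ∣ q₂ ∣ ℕ.* m ≡⟨ cong₂ ℕ._+_ (abs-* q₁ (+ m)) (abs-* q₂ (+ m)) ⟨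
    ∣ q₁ * + m ∣ ℕ.+ ∣ q₂ * + m ∣ ∎
    where
    open ℕ.≤-Reasoning
    s = ∣ q₁ ∣ ℕ.+ ∣ q₂ ∣
    s≢0 : s ≢ 0
    s≢0 s≡0 = q≢0 (cong (_* + m) (∣i∣≡0⇒i≡0 {q₁} (ℕ.m+n≡0⇒m≡0 ∣ q₁ ∣ s≡0)) ,
                   cong (_* + m) (∣i∣≡0⇒i≡0 {q₂} (ℕ.m+n≡0⇒n≡0 ∣ q₁ ∣ s≡0)))
    instance _ = ℕ.≢-nonZero s≢0

  go : ∀ x d → ¬ (x ≡ 0ℤ × d ≡ 0ℤ) → Acc ℕ._<_ (∣ x ∣ ℕ.+ ∣ d ∣) →
    ∃[ k ] ∃[ a ] ∃[ b ] (x ≡ + (m ℕ.^ k) * a × d ≡ + (m ℕ.^ k) * b × ¬ (+ m ∣ₛ a × + m ∣ₛ b))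
  go x d x,d≢0 (acc rec) with + m ∣ₛ? x | + m ∣ₛ? d
  ... | no m∤x | _ = 0 , x , d , sym (*-identityˡ x) , sym (*-identityˡ d) , m∤x ∘ proj₁
  ... | yes _ | no m∤d = 0 , x , d , sym (*-identityˡ x) , sym (*-identityˡ d) , m∤d ∘ proj₂
  ... | yes (divides q₁ refl) | yes (divides q₂ refl) =
    let k , a , b , q₁≡ , q₂≡ , m∤a,b = go q₁ q₂ q≢0 (rec (shrinks q₁ q₂ x,d≢0))
    in ℕ.suc k , a , b , rescale k q₁≡ , rescale k q₂≡ , m∤a,b
    where
    q≢0 : ¬ (q₁ ≡ 0ℤ × q₂ ≡ 0ℤ)
    q≢0 (refl , refl) = x,d≢0 (refl , refl)

open +-*-Solver using (Polynomial; solve; con; _:+_; _:-_; :-_; _:*_; _:=_)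

-- The reflective solver does not unfold f₂, so the f₂ identities go through this polynomial copy.
F₂ : ∀ {n} → Polynomial n → Polynomial n → Polynomial n → Polynomial n
F₂ x y z = con (+ 3) :* (x :* x) :+ con (+ 4) :* (y :* y) :+ con (+ 4) :* (z :* z) :+ con (+ 2) :* (y :* z)

f₂-neg : ∀ x y z → f₂ (- x) y z ≡ f₂ x y z
f₂-neg = solve 3 (λ x y z → F₂ (:- x) y z := F₂ x y z) refl

f₂-0-diagonal : ∀ z → f₂ 0ℤ z z ≡ (+ 2 * (z * z)) * + 5
f₂-0-diagonal = solve 1 (λ z → F₂ (con 0ℤ) z z := (con (+ 2) :* (z :* z)) :* con (+ 5)) refl

f₂-descent : ∀ p a b z →
  f₂ ((+ 3 * p) * a) (z + (+ 3 * p) * b) z ≡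
  f₂ (p * (a + + 2 * b)) ((- z + p * (+ 2 * a - + 2 * b)) + p * (b - + 4 * a)) (- z + p * (+ 2 * a - + 2 * b))
f₂-descent = solve 4 (λ p a b z →
  F₂ ((con (+ 3) :* p) :* a) (z :+ (con (+ 3) :* p) :* b) z :=
  F₂ (p :* (a :+ con (+ 2) :* b)) ((:- z :+ p :* (con (+ 2) :* a :- con (+ 2) :* b)) :+ p :* (b :- con (+ 4) :* a))
     (:- z :+ p :* (con (+ 2) :* a :- con (+ 2) :* b))) refl

3∣a+2b∧3∣-a+2b⇒3∣a∧3∣b : ∀ a b → + 3 ∣ₛ a + + 2 * b → + 3 ∣ₛ - a + + 2 * b → + 3 ∣ₛ a × + 3 ∣ₛ b
3∣a+2b∧3∣-a+2b⇒3∣a∧3∣b a b 3∣u 3∣v =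
  subst (+ 3 ∣ₛ_) (a≡ a b) (∣m∣n⇒∣m-n (∣m∣n⇒∣m+n (∣n⇒∣m*n (+ 2) 3∣u) 3∣v) (∣n⇒∣m*n (+ 2 * b) ∣-refl)) ,
  subst (+ 3 ∣ₛ_) (b≡ a b) (∣m∣n⇒∣m-n (∣m∣n⇒∣m+n 3∣u 3∣v) (∣n⇒∣m*n b ∣-refl))
  where
  a≡ : ∀ a b → + 2 * (a + + 2 * b) + (- a + + 2 * b) - + 2 * b * + 3 ≡ a
  a≡ = solve-∀
  b≡ : ∀ a b → (a + + 2 * b) + (- a + + 2 * b) - b * + 3 ≡ b
  b≡ = solve-∀

3∤a+2b⊎3∤-a+2b : ∀ a b → ¬ (+ 3 ∣ₛ a × + 3 ∣ₛ b) → ¬ + 3 ∣ₛ a + + 2 * b ⊎ ¬ + 3 ∣ₛ - a + + 2 * b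
3∤a+2b⊎3∤-a+2b a b 3∤a,b with + 3 ∣ₛ? a + + 2 * b | + 3 ∣ₛ? - a + + 2 * b
... | no 3∤u | _ = inj₁ 3∤u
... | yes _ | no 3∤v = inj₂ 3∤v
... | yes 3∣u | yes 3∣v = contradiction (3∣a+2b∧3∣-a+2b⇒3∣a∧3∣b a b 3∣u 3∣v) 3∤a,b

GoodRepresentation : ℤ → Set
GoodRepresentation N = ∃[ u ] ∃[ v ] ∃[ w ] (¬ (+ 3 ∣ (u + + 2 * v - + 2 * w)) × N ≡ f₂ u v w)

3∤x+2d⇒good : ∀ x d z → ¬ + 3 ∣ₛ x + + 2 * d → GoodRepresentation (f₂ x (z + d) z)
3∤x+2d⇒good x d z 3∤x+2d = x , z + d , z , 3∤x+2d ∘ subst (+ 3 ∣ₛ_) (form≡ x d z) ∘ ∣ᵤ⇒∣ , refl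
  where
  form≡ : ∀ x d z → x + + 2 * (z + d) - + 2 * z ≡ x + + 2 * d
  form≡ = solve-∀

mutual
  good-scaled : ∀ k a b z → ¬ (+ 3 ∣ₛ a × + 3 ∣ₛ b) →
    GoodRepresentation (f₂ (+ (3 ℕ.^ k) * a) (z + + (3 ℕ.^ k) * b) z)
  good-scaled k a b z 3∤a,b with 3∤a+2b⊎3∤-a+2b a b 3∤a,b
  ... | inj₁ 3∤a+2b = good-scaled-∤ k a b z 3∤a+2b
  ... | inj₂ 3∤-a+2b =
    subst GoodRepresentation (trans (cong (λ t → f₂ t y z) (sym (neg-distribʳ-* c a))) (f₂-neg (c * a) y z))
      (good-scaled-∤ k (- a) b z 3∤-a+2b)
    where
    c = + (3 ℕ.^ k)
    y = z + c * b

  good-scaled-∤ : ∀ k a b z → ¬ + 3 ∣ₛ a + + 2 * b →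
    GoodRepresentation (f₂ (+ (3 ℕ.^ k) * a) (z + + (3 ℕ.^ k) * b) z)
  good-scaled-∤ ℕ.zero a b z 3∤a+2b rewrite *-identityˡ a | *-identityˡ b = 3∤x+2d⇒good a b z 3∤a+2b
  good-scaled-∤ (ℕ.suc k) a b z 3∤a+2b =
    subst GoodRepresentation (sym (trans (cong (λ c → f₂ (c * a) (z + c * b) z) (pos-* 3 (3 ℕ.^ k))) (f₂-descent p a b z)))
      (good-scaled k (a + + 2 * b) (b - + 4 * a) (- z + p * (+ 2 * a - + 2 * b)) (3∤a+2b ∘ proj₁))
    where p = + (3 ℕ.^ k)

5∤15n+r : ∀ n r → (r ≡ 1 ⊎ r ≡ 7 ⊎ r ≡ 13) → ¬ 5 ℕ.∣ 15 ℕ.* n ℕ.+ r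
5∤15n+r n r r∈ 5∣15n+r = 5∤r r∈ (ℕ.∣m+n∣m⇒∣n 5∣15n+r (ℕ.∣m⇒∣m*n n (ℕ.divides 3 refl)))
  where
  5∤r : (r ≡ 1 ⊎ r ≡ 7 ⊎ r ≡ 13) → ¬ 5 ℕ.∣ r
  5∤r (inj₁ refl) = from-no (5 ℕ.∣? 1)
  5∤r (inj₂ (inj₁ refl)) = from-no (5 ℕ.∣? 7)
  5∤r (inj₂ (inj₂ refl)) = from-no (5 ℕ.∣? 13)

lemma5p2 : (n r : ℕ) → (r ≡ 1 ⊎ r ≡ 7 ⊎ r ≡ 13) →
    (∃[ x ] ∃[ y ] ∃[ z ] + (15 Data.Nat.* n Data.Nat.+ r) ≡ f₂ x y z) →
    ∃[ u ] ∃[ v ] ∃[ w ] (¬ (+ 3 ∣ (u + + 2 * v - + 2 * w)) × + (15 Data.Nat.* n Data.Nat.+ r) ≡ f₂ u v w)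
lemma5p2 n r r∈ (x , y , z , N≡f₂xyz) =
  let k , a , b , x≡ , y-z≡ , 3∤a,b = power-split 3 (ℕ.s≤s (ℕ.s≤s ℕ.z≤n)) x (y - z) x,y-z≢0
  in subst GoodRepresentation
       (sym (trans N≡f₂xyz (cong₂ (λ u v → f₂ u v z) x≡ (trans (y≡z+[y-z] y z) (cong (λ d → z + d) y-z≡)))))
       (good-scaled k a b z 3∤a,b)
  where
  y≡z+[y-z] : ∀ y z → y ≡ z + (y - z)
  y≡z+[y-z] = solve-∀

  x,y-z≢0 : ¬ (x ≡ 0ℤ × y - z ≡ 0ℤ)
  x,y-z≢0 (x≡0 , y-z≡0) = 5∤15n+r n r r∈ (∣⇒∣ᵤ (divides (+ 2 * (z * z)) (begin
    + (15 ℕ.* n ℕ.+ r) ≡⟨ N≡f₂xyz ⟩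
    f₂ x y z           ≡⟨ cong₂ (λ u v → f₂ u v z) x≡0 (i-j≡0⇒i≡j y z y-z≡0) ⟩
    f₂ 0ℤ z z          ≡⟨ f₂-0-diagonal z ⟩
    (+ 2 * (z * z)) * + 5 ∎)))
    where open ≡-Reasoning
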